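{- For every integer $k\ge 4$ and every pair of integers $h_1,h_2$ with $2\le h_1\le h_2$, there is a $k$-element set $A$ of integers whose coefficient lattice $\mathcal{L}$ has first $L^1$-minimum $2h_1$ and second $L^1$-minimum $2h_2$.
   Context: For a finite set $A=\{a_1<\dots<a_k\}\subseteq\mathbb{Z}$, write $\vec a=\langle a_1,\dots,a_k\rangle$ and $\vec 1=\langle 1,\dots,1\rangle\in\mathbb{Z}^k$. The coefficient lattice of $A$ is $\mathcal{L}=\{\vec c\in\mathbb{Z}^k : \vec c\cdot\vec 1=0,\ \vec c\cdot\vec a=0\}$, a lattice of dimension $k-2$. For $i\ge1$, the $i$-th successive $L^1$-minimum $\lambda_i$ of $\mathcal{L}$ is the infimum of those $\lambda$ such that $\{\vec c\in\mathcal{L}:\|\vec c\|_1\le\lambda\}$ contains $i$ linearly independent vectors. The first and second $L^1$-minima are $\lambda_1$ and $\lambda_2$. -}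

module Defs where

open import Data.Nat as ℕ using (ℕ; zero; suc)
open import Data.Integer as ℤ using (ℤ; ∣_∣)
open import Data.Fin using (Fin)
open import Data.Product using (Σ; _×_; ∃)
open import Relation.Binary.PropositionalEquality using (_≡_)
open import Relation.Nullary using (¬_)
import Data.Fin

sumℤ : ∀ {n} → (Fin n → ℤ) → ℤ
sumℤ {zero}  f = ℤ.0ℤ
sumℤ {suc n} f = f Data.Fin.zero ℤ.+ sumℤ (λ j → f (Data.Fin.suc j))

sumℕ : ∀ {n} → (Fin n → ℕ) → ℕ
sumℕ {zero}  f = 0
sumℕ {suc n} f = f Data.Fin.zero ℕ.+ sumℕ (λ j → f (Data.Fin.suc j))

Vecℤ : ℕ → Set
Vecℤ k = Fin k → ℤ

dot : ∀ {k} → Vecℤ k → Vecℤ k → ℤ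
dot u v = sumℤ (λ j → u j ℤ.* v j)

one : ∀ {k} → Vecℤ k
one _ = ℤ.1ℤ

norm₁ : ∀ {k} → Vecℤ k → ℕ
norm₁ c = sumℕ (λ j → ∣ c j ∣)

-- A = {a₁ < … < aₖ} given by its strictly increasing enumeration
StrictlyIncreasing : ∀ {k} → Vecℤ k → Set
StrictlyIncreasing {k} a = ∀ (i j : Fin k) → i Data.Fin.< j → a i ℤ.< a j

InLattice : ∀ {k} → Vecℤ k → Vecℤ k → Set
InLattice a c = (dot c one ≡ ℤ.0ℤ) × (dot c a ≡ ℤ.0ℤ)

-- linear independence of a family of i integer vectors
-- (over ℤ; equivalent to independence over ℚ/ℝ by clearing denominators)
LinIndep : ∀ {i k} → (Fin i → Vecℤ k) → Set
LinIndep {i} {k} v =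
  ∀ (α : Fin i → ℤ) →
    (∀ (t : Fin k) → sumℤ (λ j → α j ℤ.* v j t) ≡ ℤ.0ℤ) →
    ∀ (j : Fin i) → α j ≡ ℤ.0ℤ

HasIndepWithin : ∀ {k} → Vecℤ k → ℕ → ℕ → Set
HasIndepWithin {k} a i m =
  Σ (Fin i → Vecℤ k) λ v →
    (∀ j → InLattice a (v j)) × LinIndep v × (∀ j → norm₁ (v j) ℕ.≤ m)

-- Since L¹ norms of integer vectors are natural numbers, the infimum
-- is attained and equals m iff m works and no smaller natural works.
IsSuccMin : ∀ {k} → Vecℤ k → ℕ → ℕ → Set
IsSuccMin a i m = HasIndepWithin a i m × (∀ m' → m' ℕ.< m → ¬ HasIndepWithin a i m')

-- For A₀ = {0, 1, h₁, h₁h₂} the coefficient lattice has the basis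
-- U = (h₁ − 1, −h₁, 1, 0) and V = (h₂ − 1, 0, −h₂, 1), of L¹ norms 2h₁ and 2h₂,
-- and a lattice vector s U + w V has L¹ norm at least 2h₂ |w|.  So the vectors
-- of norm below 2h₂ are the multiples of U, of norm 2h₁ |s|, which pins down both
-- minima.  Larger sets are obtained by repeatedly adding a new least element g
-- with |g| > 2h₂ · max |aᵢ|: a lattice vector of norm below 2h₂ must then have
-- coefficient 0 at g, so no new short vectors appear.
module Submission where

open import Defs

-- The integer operators are opened only inside this block, so that the
-- theorem at the end is stated with those of ℕ.
module _ where
  open import Data.Nat as ℕ using (ℕ; zero; suc; s≤s; z≤n)
  import Data.Nat.Properties as ℕₚ
  import Data.Nat.Tactic.RingSolver as ℕ-Solver
  open import Data.Integer using (ℤ; ∣_∣; +_; -[1+_]; 0ℤ; 1ℤ; _+_; _-_; _*_; -_; _<_; +<+; -<+; -<-)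
  import Data.Integer.Properties as ℤₚ
  import Data.Integer.Tactic.RingSolver as ℤ-Solver
  open import Algebra.Properties.AbelianGroup ℤₚ.+-0-abelianGroup using (inverseˡ-unique)
  open import Data.Fin using (Fin; zero; suc)
  open import Data.Vec.Functional using ([]; _∷_; tail)
  open import Data.Product using (Σ; _,_; proj₁; proj₂)
  open import Function using (_∘_)
  open import Relation.Binary.PropositionalEquality
  open import Relation.Nullary using (¬_; contradiction)

  ∣i∣*m<m⇒i≡0 : ∀ i m → ∣ i ∣ ℕ.* m ℕ.< m → i ≡ 0ℤ
  ∣i∣*m<m⇒i≡0 i m lt with ∣ i ∣ in ∣i∣≡n
  ... | zero  = ℤₚ.∣i∣≡0⇒i≡0 ∣i∣≡n
  ... | suc n = contradiction lt (ℕₚ.≤⇒≯ (ℕₚ.m≤m+n m (n ℕ.* m)))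

  i+j≡0⇒∣i∣≡∣j∣ : ∀ i j → i + j ≡ 0ℤ → ∣ i ∣ ≡ ∣ j ∣
  i+j≡0⇒∣i∣≡∣j∣ i j i+j≡0 = trans (cong ∣_∣ (inverseˡ-unique i j i+j≡0)) (ℤₚ.∣-i∣≡∣i∣ j)

  ∣i∣≤n⇒-[1+n]<i : ∀ {i n} → ∣ i ∣ ℕ.≤ n → -[1+ n ] < i
  ∣i∣≤n⇒-[1+n]<i {+ _}      _   = -<+
  ∣i∣≤n⇒-[1+n]<i { -[1+ _ ]} k<n = -<- k<n

  sumℤ-zero : ∀ {n} {f : Fin n → ℤ} → (∀ j → f j ≡ 0ℤ) → sumℤ f ≡ 0ℤ
  sumℤ-zero {zero}  _     = refl
  sumℤ-zero {suc n} f≡0 = cong₂ _+_ (f≡0 zero) (sumℤ-zero (f≡0 ∘ suc))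

  norm₁-cong : ∀ {n} {u v : Vecℤ n} → (∀ i → u i ≡ v i) → norm₁ u ≡ norm₁ v
  norm₁-cong {zero}  _   = refl
  norm₁-cong {suc n} u≡v = cong₂ ℕ._+_ (cong ∣_∣ (u≡v zero)) (norm₁-cong (u≡v ∘ suc))

  norm₁-scale : ∀ {n} t (u : Vecℤ n) → norm₁ (λ i → t * u i) ≡ ∣ t ∣ ℕ.* norm₁ u
  norm₁-scale {zero}  t u = sym (ℕₚ.*-zeroʳ ∣ t ∣)
  norm₁-scale {suc n} t u = begin
    ∣ t * u zero ∣ ℕ.+ norm₁ (λ i → t * tail u i)
      ≡⟨ cong₂ ℕ._+_ (ℤₚ.abs-* t (u zero)) (norm₁-scale t (tail u)) ⟩
    ∣ t ∣ ℕ.* ∣ u zero ∣ ℕ.+ ∣ t ∣ ℕ.* norm₁ (tail u)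
      ≡⟨ ℕₚ.*-distribˡ-+ ∣ t ∣ ∣ u zero ∣ (norm₁ (tail u)) ⟨
    ∣ t ∣ ℕ.* norm₁ u
      ∎
    where open ≡-Reasoning

  ∣dot∣≤norm₁*bound : ∀ {n} (c b : Vecℤ n) {M} → (∀ i → ∣ b i ∣ ℕ.≤ M) →
                      ∣ dot c b ∣ ℕ.≤ norm₁ c ℕ.* M
  ∣dot∣≤norm₁*bound {zero}  c b b≤M = z≤n
  ∣dot∣≤norm₁*bound {suc n} c b {M} b≤M = begin
    ∣ c zero * b zero + dot (tail c) (tail b) ∣
      ≤⟨ ℤₚ.∣i+j∣≤∣i∣+∣j∣ (c zero * b zero) _ ⟩
    ∣ c zero * b zero ∣ ℕ.+ ∣ dot (tail c) (tail b) ∣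
      ≡⟨ cong (ℕ._+ ∣ dot (tail c) (tail b) ∣) (ℤₚ.abs-* (c zero) (b zero)) ⟩
    ∣ c zero ∣ ℕ.* ∣ b zero ∣ ℕ.+ ∣ dot (tail c) (tail b) ∣
      ≤⟨ ℕₚ.+-mono-≤ (ℕₚ.*-monoʳ-≤ ∣ c zero ∣ (b≤M zero))
                     (∣dot∣≤norm₁*bound (tail c) (tail b) (b≤M ∘ suc)) ⟩
    ∣ c zero ∣ ℕ.* M ℕ.+ norm₁ (tail c) ℕ.* M
      ≡⟨ ℕₚ.*-distribʳ-+ M ∣ c zero ∣ (norm₁ (tail c)) ⟨
    norm₁ c ℕ.* M
      ∎
    where open ℕₚ.≤-Reasoning

  dot-head≡0 : ∀ {n} (c b : Vecℤ (suc n)) → c zero ≡ 0ℤ → dot c b ≡ dot (tail c) (tail b)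
  dot-head≡0 c b c₀≡0 =
    trans (cong (λ x → x * b zero + dot (tail c) (tail b)) c₀≡0) (ℤₚ.+-identityˡ _)

  InLattice-∷ : ∀ {n} g {a u : Vecℤ n} → InLattice a u → InLattice (g ∷ a) (0ℤ ∷ u)
  InLattice-∷ g {a} {u} (u·1≡0 , u·a≡0) =
    trans (dot-head≡0 (0ℤ ∷ u) one refl) u·1≡0 , trans (dot-head≡0 (0ℤ ∷ u) (g ∷ a) refl) u·a≡0

  InLattice-tail : ∀ {n g} {a : Vecℤ n} {c} → InLattice (g ∷ a) c → c zero ≡ 0ℤ →
                   InLattice a (tail c)
  InLattice-tail {g = g} {a} {c} (c·1≡0 , c·a≡0) c₀≡0 =
    trans (sym (dot-head≡0 c one c₀≡0)) c·1≡0 , trans (sym (dot-head≡0 c (g ∷ a) c₀≡0)) c·a≡0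

  InLattice-∷⇒head≡0 : ∀ {n g} {a : Vecℤ n} {c} M → (∀ i → ∣ a i ∣ ℕ.≤ M) → InLattice (g ∷ a) c →
                       norm₁ (tail c) ℕ.* M ℕ.< ∣ g ∣ → c zero ≡ 0ℤ
  InLattice-∷⇒head≡0 {g = g} {a} {c} M a≤M (_ , c·a≡0) tail-small =
    ∣i∣*m<m⇒i≡0 (c zero) ∣ g ∣ (begin-strict
      ∣ c zero ∣ ℕ.* ∣ g ∣   ≡⟨ ℤₚ.abs-* (c zero) g ⟨
      ∣ c zero * g ∣         ≡⟨ i+j≡0⇒∣i∣≡∣j∣ (c zero * g) _ c·a≡0 ⟩
      ∣ dot (tail c) a ∣     ≤⟨ ∣dot∣≤norm₁*bound (tail c) a a≤M ⟩
      norm₁ (tail c) ℕ.* M   <⟨ tail-small ⟩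
      ∣ g ∣                  ∎)
    where open ℕₚ.≤-Reasoning

  StrictlyIncreasing-[x] : ∀ x → StrictlyIncreasing (x ∷ [])
  StrictlyIncreasing-[x] x zero zero ()

  StrictlyIncreasing-∷ : ∀ {n x} {a : Vecℤ (suc n)} → StrictlyIncreasing a → x < a zero →
                         StrictlyIncreasing (x ∷ a)
  StrictlyIncreasing-∷ a↑ x<a₀ zero    (suc zero)    _ = x<a₀
  StrictlyIncreasing-∷ a↑ x<a₀ zero    (suc (suc j)) _ = ℤₚ.<-trans x<a₀ (a↑ zero (suc j) (s≤s z≤n))
  StrictlyIncreasing-∷ a↑ x<a₀ (suc i) (suc j) (s≤s i<j) = a↑ i j i<j

  LinIndep⇒head≢0 : ∀ {i k} {v : Fin (suc i) → Vecℤ k} → LinIndep v → ¬ (∀ t → v zero t ≡ 0ℤ)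
  LinIndep⇒head≢0 {v = v} indep v₀≡0 = 1≢0 (indep (1ℤ ∷ λ _ → 0ℤ) combination≡0 zero)
    where
    1≢0 : 1ℤ ≢ 0ℤ
    1≢0 ()
    combination≡0 : ∀ t → 1ℤ * v zero t + sumℤ (λ j → 0ℤ * v (suc j) t) ≡ 0ℤ
    combination≡0 t = cong₂ _+_ (trans (ℤₚ.*-identityˡ (v zero t)) (v₀≡0 t))
                                (sumℤ-zero {f = λ j → 0ℤ * v (suc j) t} λ _ → refl)

  multiples-¬LinIndep : ∀ {k} {v : Fin 2 → Vecℤ k} (u : Vecℤ k) (s : Fin 2 → ℤ) →
                        (∀ j t → v j t ≡ s j * u t) → ¬ LinIndep v
  multiples-¬LinIndep {v = v} u s v≡su indep = LinIndep⇒head≢0 {v = v} indep v₀≡0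
    where
    s₀ s₁ : ℤ
    s₀ = s zero
    s₁ = s (suc zero)
    cancel : ∀ a b x → b * (a * x) + (- a * (b * x) + 0ℤ) ≡ 0ℤ
    cancel = ℤ-Solver.solve-∀
    combination≡0 : ∀ t → s₁ * v zero t + (- s₀ * v (suc zero) t + 0ℤ) ≡ 0ℤ
    combination≡0 t =
      trans (cong₂ (λ x y → s₁ * x + (- s₀ * y + 0ℤ)) (v≡su zero t) (v≡su (suc zero) t))
            (cancel s₀ s₁ (u t))
    s₀≡0 : s₀ ≡ 0ℤ
    s₀≡0 = ℤₚ.neg-injective (indep (s₁ ∷ - s₀ ∷ []) combination≡0 (suc zero))
    v₀≡0 : ∀ t → v zero t ≡ 0ℤ
    v₀≡0 t = trans (v≡su zero t) (cong (_* u t) s₀≡0)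

  LinIndep-∷ : ∀ {i k} {v : Fin i → Vecℤ k} → LinIndep v → LinIndep (λ j → 0ℤ ∷ v j)
  LinIndep-∷ indep α combination≡0 = indep α (combination≡0 ∘ suc)

  module Construction (p r : ℕ) where

    h₁ h₂ : ℕ
    h₁ = 2 ℕ.+ p
    h₂ = 2 ℕ.+ r

    H₁ H₂ : ℤ
    H₁ = + h₁
    H₂ = + h₂

    a₀ U₀ V₀ : Vecℤ 4
    a₀ = 0ℤ ∷ 1ℤ ∷ H₁ ∷ H₁ * H₂ ∷ []
    U₀ = H₁ - 1ℤ ∷ - H₁ ∷ 1ℤ ∷ 0ℤ ∷ []
    V₀ = H₂ - 1ℤ ∷ 0ℤ ∷ - H₂ ∷ 1ℤ ∷ []

    basis₀ : Fin 2 → Vecℤ 4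
    basis₀ = U₀ ∷ V₀ ∷ []

    basis₀∈L : ∀ j → InLattice a₀ (basis₀ j)
    basis₀∈L zero       = U₀·1≡0 H₁ , U₀·a₀≡0 H₁ H₂
      where
      U₀·1≡0 : ∀ h → (h - 1ℤ) * 1ℤ + (- h * 1ℤ + (1ℤ * 1ℤ + (0ℤ * 1ℤ + 0ℤ))) ≡ 0ℤ
      U₀·1≡0 = ℤ-Solver.solve-∀
      U₀·a₀≡0 : ∀ h h' → (h - 1ℤ) * 0ℤ + (- h * 1ℤ + (1ℤ * h + (0ℤ * (h * h') + 0ℤ))) ≡ 0ℤ
      U₀·a₀≡0 = ℤ-Solver.solve-∀
    basis₀∈L (suc zero) = V₀·1≡0 H₂ , V₀·a₀≡0 H₁ H₂
      where
      V₀·1≡0 : ∀ h' → (h' - 1ℤ) * 1ℤ + (0ℤ * 1ℤ + (- h' * 1ℤ + (1ℤ * 1ℤ + 0ℤ))) ≡ 0ℤ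
      V₀·1≡0 = ℤ-Solver.solve-∀
      V₀·a₀≡0 : ∀ h h' → (h' - 1ℤ) * 0ℤ + (0ℤ * 1ℤ + (- h' * h + (1ℤ * (h * h') + 0ℤ))) ≡ 0ℤ
      V₀·a₀≡0 = ℤ-Solver.solve-∀

    norm₁-U₀ : norm₁ U₀ ≡ 2 ℕ.* h₁
    norm₁-U₀ = identity p
      where
      identity : ∀ p → suc p ℕ.+ (suc (suc p) ℕ.+ (1 ℕ.+ (0 ℕ.+ 0))) ≡ 2 ℕ.* suc (suc p)
      identity = ℕ-Solver.solve-∀

    norm₁-V₀ : norm₁ V₀ ≡ 2 ℕ.* h₂
    norm₁-V₀ = identity r
      where
      identity : ∀ r → suc r ℕ.+ (0 ℕ.+ (suc (suc r) ℕ.+ (1 ℕ.+ 0))) ≡ 2 ℕ.* suc (suc r)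
      identity = ℕ-Solver.solve-∀

    U₀-indep : LinIndep {1} (λ _ → U₀)
    U₀-indep α combination≡0 zero =
      trans (sym (trans (ℤₚ.+-identityʳ _) (ℤₚ.*-identityʳ _))) (combination≡0 (suc (suc zero)))

    basis₀-indep : LinIndep basis₀
    basis₀-indep α combination≡0 = λ { zero → α₀≡0 ; (suc zero) → α₁≡0 }
      where
      α₁-coordinate : ∀ α₀ α₁ → α₀ * 0ℤ + (α₁ * 1ℤ + 0ℤ) ≡ α₁
      α₁-coordinate = ℤ-Solver.solve-∀
      α₁≡0 : α (suc zero) ≡ 0ℤ
      α₁≡0 = trans (sym (α₁-coordinate (α zero) (α (suc zero))))
                   (combination≡0 (suc (suc (suc zero))))
      α₀≡0 : α zero ≡ 0ℤ
      α₀≡0 = begin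
        α zero                                    ≡⟨ trans (ℤₚ.+-identityʳ _) (ℤₚ.*-identityʳ _) ⟨
        α zero * 1ℤ + (0ℤ * - H₂ + 0ℤ)            ≡⟨ cong (λ x → α zero * 1ℤ + (x * - H₂ + 0ℤ)) α₁≡0 ⟨
        α zero * 1ℤ + (α (suc zero) * - H₂ + 0ℤ)  ≡⟨ combination≡0 (suc (suc zero)) ⟩
        0ℤ                                        ∎
        where open ≡-Reasoning

    combination₀ : ℤ → ℤ → Vecℤ 4
    combination₀ s w i = s * U₀ i + w * V₀ i

    L₀-spanned : ∀ c → InLattice a₀ c → Σ ℤ λ s → Σ ℤ λ w → ∀ i → c i ≡ combination₀ s w i
    L₀-spanned c (c·1≡0 , c·a₀≡0) = z + H₂ * w , w , λ
      { zero                   → cancel-zeros (x-coordinate x y z w H₁ H₂) c·1≡0 c·a₀≡0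
      ; (suc zero)             → cancel-zeros (y-coordinate x y z w H₁ H₂) c·a₀≡0 refl
      ; (suc (suc zero))       → z-coordinate z w H₂
      ; (suc (suc (suc zero))) → w-coordinate z w H₂
      }
      where
      x = c zero
      y = c (suc zero)
      z = c (suc (suc zero))
      w = c (suc (suc (suc zero)))
      cancel-zeros : ∀ {a b e e'} → a ≡ b + (e - e') → e ≡ 0ℤ → e' ≡ 0ℤ → a ≡ b
      cancel-zeros a≡b+e-e' refl refl = trans a≡b+e-e' (ℤₚ.+-identityʳ _)
      x-coordinate : ∀ x y z w h h' → x ≡ (z + h' * w) * (h - 1ℤ) + w * (h' - 1ℤ) +
        ((x * 1ℤ + (y * 1ℤ + (z * 1ℤ + (w * 1ℤ + 0ℤ)))) -
         (x * 0ℤ + (y * 1ℤ + (z * h + (w * (h * h') + 0ℤ)))))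
      x-coordinate = ℤ-Solver.solve-∀
      y-coordinate : ∀ x y z w h h' → y ≡ (z + h' * w) * (- h) + w * 0ℤ +
        ((x * 0ℤ + (y * 1ℤ + (z * h + (w * (h * h') + 0ℤ)))) - 0ℤ)
      y-coordinate = ℤ-Solver.solve-∀
      z-coordinate : ∀ z w h' → z ≡ (z + h' * w) * 1ℤ + w * (- h')
      z-coordinate = ℤ-Solver.solve-∀
      w-coordinate : ∀ z w h' → w ≡ (z + h' * w) * 0ℤ + w * 1ℤ
      w-coordinate = ℤ-Solver.solve-∀

    -- From h₂ w = s − e₂ and (h₂ − 1) w = e₀ − (h₁ − 1) s, where e₀, …, e₃ are the
    -- coordinates of s U₀ + w V₀, by the triangle inequality.
    norm₁-combination₀≥ : ∀ s w → ∣ w ∣ ℕ.* (2 ℕ.* h₂) ℕ.≤ norm₁ (combination₀ s w)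
    norm₁-combination₀≥ s w = begin
      ∣ w ∣ ℕ.* (2 ℕ.* h₂)
        ≡⟨ split (∣ w ∣) r ⟩
      h₂ ℕ.* ∣ w ∣ ℕ.+ (suc r ℕ.* ∣ w ∣ ℕ.+ ∣ w ∣)
        ≤⟨ ℕₚ.+-mono-≤ via-e₂ (ℕₚ.+-mono-≤ via-e₀ (ℕₚ.≤-reflexive (sym ∣e₃∣≡∣w∣))) ⟩
      (∣ s ∣ ℕ.+ ∣ e₂ ∣) ℕ.+ ((∣ e₀ ∣ ℕ.+ suc p ℕ.* ∣ s ∣) ℕ.+ ∣ e₃ ∣)
        ≡⟨ regroup (∣ s ∣) (∣ e₀ ∣) (∣ e₂ ∣) (∣ e₃ ∣) p ⟩
      ∣ e₀ ∣ ℕ.+ (h₁ ℕ.* ∣ s ∣ ℕ.+ (∣ e₂ ∣ ℕ.+ (∣ e₃ ∣ ℕ.+ 0)))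
        ≡⟨ cong (λ n → ∣ e₀ ∣ ℕ.+ (n ℕ.+ (∣ e₂ ∣ ℕ.+ (∣ e₃ ∣ ℕ.+ 0)))) ∣e₁∣≡h₁∣s∣ ⟨
      norm₁ (combination₀ s w)
        ∎
      where
      open ℕₚ.≤-Reasoning
      e₀ e₁ e₂ e₃ : ℤ
      e₀ = s * (H₁ - 1ℤ) + w * (H₂ - 1ℤ)
      e₁ = s * - H₁ + w * 0ℤ
      e₂ = s * 1ℤ + w * - H₂
      e₃ = s * 0ℤ + w * 1ℤ
      e₀-form : ∀ s w h h' → (h' - 1ℤ) * w ≡ (s * (h - 1ℤ) + w * (h' - 1ℤ)) - (h - 1ℤ) * s
      e₀-form = ℤ-Solver.solve-∀
      e₁-form : ∀ s w h → s * - h + w * 0ℤ ≡ - (h * s)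
      e₁-form = ℤ-Solver.solve-∀
      e₂-form : ∀ s w h' → h' * w ≡ s - (s * 1ℤ + w * - h')
      e₂-form = ℤ-Solver.solve-∀
      e₃-form : ∀ s w → s * 0ℤ + w * 1ℤ ≡ w
      e₃-form = ℤ-Solver.solve-∀
      ∣e₁∣≡h₁∣s∣ : ∣ e₁ ∣ ≡ h₁ ℕ.* ∣ s ∣
      ∣e₁∣≡h₁∣s∣ = trans (cong ∣_∣ (e₁-form s w H₁)) (trans (ℤₚ.∣-i∣≡∣i∣ (H₁ * s)) (ℤₚ.abs-* H₁ s))
      ∣e₃∣≡∣w∣ : ∣ e₃ ∣ ≡ ∣ w ∣
      ∣e₃∣≡∣w∣ = cong ∣_∣ (e₃-form s w)
      via-e₂ : h₂ ℕ.* ∣ w ∣ ℕ.≤ ∣ s ∣ ℕ.+ ∣ e₂ ∣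
      via-e₂ = subst (ℕ._≤ ∣ s ∣ ℕ.+ ∣ e₂ ∣)
                     (trans (cong ∣_∣ (sym (e₂-form s w H₂))) (ℤₚ.abs-* H₂ w))
                     (ℤₚ.∣i-j∣≤∣i∣+∣j∣ s e₂)
      via-e₀ : suc r ℕ.* ∣ w ∣ ℕ.≤ ∣ e₀ ∣ ℕ.+ suc p ℕ.* ∣ s ∣
      via-e₀ = subst₂ ℕ._≤_ (trans (cong ∣_∣ (sym (e₀-form s w H₁ H₂))) (ℤₚ.abs-* (H₂ - 1ℤ) w))
                            (cong (∣ e₀ ∣ ℕ.+_) (ℤₚ.abs-* (H₁ - 1ℤ) s))
                            (ℤₚ.∣i-j∣≤∣i∣+∣j∣ e₀ ((H₁ - 1ℤ) * s))
      split : ∀ W r → W ℕ.* (2 ℕ.* suc (suc r)) ≡ suc (suc r) ℕ.* W ℕ.+ (suc r ℕ.* W ℕ.+ W)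
      split = ℕ-Solver.solve-∀
      regroup : ∀ S E₀ E₂ E₃ p → (S ℕ.+ E₂) ℕ.+ ((E₀ ℕ.+ suc p ℕ.* S) ℕ.+ E₃) ≡
                                 E₀ ℕ.+ (suc (suc p) ℕ.* S ℕ.+ (E₂ ℕ.+ (E₃ ℕ.+ 0)))
      regroup = ℕ-Solver.solve-∀

    padded : ∀ m → Vecℤ 4 → Vecℤ (4 ℕ.+ m)
    padded zero    u = u
    padded (suc m) u = 0ℤ ∷ padded m u

    G : ℕ → ℕ
    G zero    = h₁ ℕ.* h₂
    G (suc m) = suc (2 ℕ.* h₂ ℕ.* G m)

    a : ∀ m → Vecℤ (4 ℕ.+ m)
    a zero    = a₀
    a (suc m) = -[1+ 2 ℕ.* h₂ ℕ.* G m ] ∷ a m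

    G≤2h₂G : ∀ m → G m ℕ.≤ 2 ℕ.* h₂ ℕ.* G m
    G≤2h₂G m = ℕₚ.m≤n*m (G m) (2 ℕ.* h₂)

    ∣a∣≤G : ∀ m i → ∣ a m i ∣ ℕ.≤ G m
    ∣a∣≤G zero    zero                   = z≤n
    ∣a∣≤G zero    (suc zero)             = s≤s z≤n
    ∣a∣≤G zero    (suc (suc zero))       = ℕₚ.m≤m*n h₁ h₂
    ∣a∣≤G zero    (suc (suc (suc zero))) = ℕₚ.≤-refl
    ∣a∣≤G (suc m) zero                   = ℕₚ.≤-refl
    ∣a∣≤G (suc m) (suc i)                = ℕₚ.≤-trans (∣a∣≤G m i) (ℕₚ.m≤n⇒m≤1+n (G≤2h₂G m))

    a-increasing : ∀ m → StrictlyIncreasing (a m)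
    a-increasing zero    =
      StrictlyIncreasing-∷ (StrictlyIncreasing-∷ (StrictlyIncreasing-∷ (StrictlyIncreasing-[x] (H₁ * H₂))
        h₁<h₁h₂) 1<h₁) 0<1
      where
      0<1 : 0ℤ < 1ℤ
      0<1 = +<+ (s≤s z≤n)
      1<h₁ : 1ℤ < H₁
      1<h₁ = +<+ (s≤s (s≤s z≤n))
      h₁<h₁h₂ : H₁ < H₁ * H₂
      h₁<h₁h₂ = +<+ (ℕₚ.m<m*n h₁ h₂ (s≤s (s≤s z≤n)))
    a-increasing (suc m) =
      StrictlyIncreasing-∷ (a-increasing m) (∣i∣≤n⇒-[1+n]<i (ℕₚ.≤-trans (∣a∣≤G m zero) (G≤2h₂G m)))

    padded∈L : ∀ m {u} → InLattice a₀ u → InLattice (a m) (padded m u)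
    padded∈L zero    u∈L = u∈L
    padded∈L (suc m) {u} u∈L =
      InLattice-∷ (a (suc m) zero) {a m} {padded m u} (padded∈L m {u} u∈L)

    norm₁-padded : ∀ m u → norm₁ (padded m u) ≡ norm₁ u
    norm₁-padded zero    u = refl
    norm₁-padded (suc m) u = norm₁-padded m u

    LinIndep-padded : ∀ m {i} (v : Fin i → Vecℤ 4) → LinIndep v → LinIndep (λ j → padded m (v j))
    LinIndep-padded zero    v indep = indep
    LinIndep-padded (suc m) v indep = LinIndep-∷ (LinIndep-padded m v indep)

    short⇒multiple-of-U : ∀ m c → InLattice (a m) c → norm₁ c ℕ.< 2 ℕ.* h₂ →
                          Σ ℤ λ s → ∀ i → c i ≡ s * padded m U₀ i
    short⇒multiple-of-U zero c c∈L short with L₀-spanned c c∈L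
    ... | s , w , c≡sU₀+wV₀ = s , λ i → trans (c≡sU₀+wV₀ i) (drop-V₀ i)
      where
      w≡0 : w ≡ 0ℤ
      w≡0 = ∣i∣*m<m⇒i≡0 w (2 ℕ.* h₂) (ℕₚ.≤-<-trans (norm₁-combination₀≥ s w)
              (subst (ℕ._< 2 ℕ.* h₂) (norm₁-cong c≡sU₀+wV₀) short))
      drop-V₀ : ∀ i → combination₀ s w i ≡ s * U₀ i
      drop-V₀ i = trans (cong (λ w → s * U₀ i + w * V₀ i) w≡0) (ℤₚ.+-identityʳ _)
    short⇒multiple-of-U (suc m) c c∈L short = s , λ
      { zero    → trans c₀≡0 (sym (ℤₚ.*-zeroʳ s))
      ; (suc i) → proj₂ tail-multiple i
      }
      where
      tail-short : norm₁ (tail c) ℕ.< 2 ℕ.* h₂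
      tail-short = ℕₚ.≤-<-trans (ℕₚ.m≤n+m _ ∣ c zero ∣) short
      c₀≡0 : c zero ≡ 0ℤ
      c₀≡0 = InLattice-∷⇒head≡0 {a = a m} {c} (G m) (∣a∣≤G m) c∈L
               (s≤s (ℕₚ.*-monoˡ-≤ (G m) (ℕₚ.<⇒≤ tail-short)))
      tail-multiple : Σ ℤ λ s → ∀ i → tail c i ≡ s * padded m U₀ i
      tail-multiple = short⇒multiple-of-U m (tail c) (InLattice-tail {a = a m} {c} c∈L c₀≡0) tail-short
      s : ℤ
      s = proj₁ tail-multiple

    2h₁≤2h₂ : p ℕ.≤ r → 2 ℕ.* h₁ ℕ.≤ 2 ℕ.* h₂
    2h₁≤2h₂ p≤r = ℕₚ.*-monoʳ-≤ 2 (s≤s (s≤s p≤r))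

    short⇒zero : p ℕ.≤ r → ∀ m c → InLattice (a m) c → norm₁ c ℕ.< 2 ℕ.* h₁ → ∀ i → c i ≡ 0ℤ
    short⇒zero p≤r m c c∈L short i = trans (proj₂ multiple i) (cong (_* padded m U₀ i) s≡0)
      where
      multiple : Σ ℤ λ s → ∀ i → c i ≡ s * padded m U₀ i
      multiple = short⇒multiple-of-U m c c∈L (ℕₚ.<-≤-trans short (2h₁≤2h₂ p≤r))
      s : ℤ
      s = proj₁ multiple
      s≡0 : s ≡ 0ℤ
      s≡0 = ∣i∣*m<m⇒i≡0 s (2 ℕ.* h₁) (begin-strict
        ∣ s ∣ ℕ.* (2 ℕ.* h₁)             ≡⟨ cong (∣ s ∣ ℕ.*_) (trans (norm₁-padded m U₀) norm₁-U₀) ⟨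
        ∣ s ∣ ℕ.* norm₁ (padded m U₀)    ≡⟨ norm₁-scale s (padded m U₀) ⟨
        norm₁ (λ i → s * padded m U₀ i)  ≡⟨ norm₁-cong (proj₂ multiple) ⟨
        norm₁ c                          <⟨ short ⟩
        2 ℕ.* h₁                         ∎)
        where open ℕₚ.≤-Reasoning

    first-minimum : p ℕ.≤ r → ∀ m → IsSuccMin (a m) 1 (2 ℕ.* h₁)
    first-minimum p≤r m = attained , no-shorter
      where
      attained : HasIndepWithin (a m) 1 (2 ℕ.* h₁)
      attained = (λ _ → padded m U₀) , (λ _ → padded∈L m (basis₀∈L zero)) ,
                 LinIndep-padded m (λ _ → U₀) U₀-indep ,
                 λ _ → ℕₚ.≤-reflexive (trans (norm₁-padded m U₀) norm₁-U₀)
      no-shorter : ∀ m' → m' ℕ.< 2 ℕ.* h₁ → ¬ HasIndepWithin (a m) 1 m'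
      no-shorter m' m'<2h₁ (v , v∈L , indep , v≤m') =
        LinIndep⇒head≢0 {v = v} indep
          (short⇒zero p≤r m (v zero) (v∈L zero) (ℕₚ.≤-<-trans (v≤m' zero) m'<2h₁))

    second-minimum : p ℕ.≤ r → ∀ m → IsSuccMin (a m) 2 (2 ℕ.* h₂)
    second-minimum p≤r m = attained , no-shorter
      where
      basis₀≤2h₂ : ∀ j → norm₁ (basis₀ j) ℕ.≤ 2 ℕ.* h₂
      basis₀≤2h₂ zero       = ℕₚ.≤-trans (ℕₚ.≤-reflexive norm₁-U₀) (2h₁≤2h₂ p≤r)
      basis₀≤2h₂ (suc zero) = ℕₚ.≤-reflexive norm₁-V₀
      attained : HasIndepWithin (a m) 2 (2 ℕ.* h₂)
      attained = (λ j → padded m (basis₀ j)) , (λ j → padded∈L m (basis₀∈L j)) ,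
                 LinIndep-padded m basis₀ basis₀-indep ,
                 λ j → ℕₚ.≤-trans (ℕₚ.≤-reflexive (norm₁-padded m (basis₀ j))) (basis₀≤2h₂ j)
      no-shorter : ∀ m' → m' ℕ.< 2 ℕ.* h₂ → ¬ HasIndepWithin (a m) 2 m'
      no-shorter m' m'<2h₂ (v , v∈L , indep , v≤m') =
        multiples-¬LinIndep (padded m U₀) (proj₁ ∘ multiple) (proj₂ ∘ multiple) indep
        where
        multiple : ∀ j → Σ ℤ λ s → ∀ i → v j i ≡ s * padded m U₀ i
        multiple j = short⇒multiple-of-U m (v j) (v∈L j) (ℕₚ.≤-<-trans (v≤m' j) m'<2h₂)

open import Data.Nat using (ℕ; _≤_; _*_; s≤s; z≤n)
open import Data.Product using (Σ; _×_; _,_)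

lemma1 : (k h₁ h₂ : ℕ) → 4 ≤ k → 2 ≤ h₁ → h₁ ≤ h₂ →
    Σ (Vecℤ k) λ a →
      StrictlyIncreasing a × IsSuccMin a 1 (2 * h₁) × IsSuccMin a 2 (2 * h₂)
lemma1 _ _ _ (s≤s (s≤s (s≤s (s≤s (z≤n {m}))))) (s≤s (s≤s z≤n)) (s≤s (s≤s {p} {r} p≤r)) =
  a m , a-increasing m , first-minimum p≤r m , second-minimum p≤r m
  where open Construction p r
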